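{- Let $n,m$ be positive integers and let $A$ be an $n\times m$ binary matrix that is semi-canonical, with $r(A)=\langle x_1,\dots,x_n\rangle$ and $c(A)=\langle y_1,\dots,y_m\rangle$. Then there exist integers $s,t$ with $0\le s\le m$, $0\le t\le n$ such that $x_1=2^s-1$ and $y_1=2^t-1$.
   Context: A binary matrix is a matrix with entries in $\{0,1\}$. For an $n\times m$ binary matrix $A=[a_{ij}]$, let $r(A)=\langle x_1,\dots,x_n\rangle$ where $x_i$ is the natural number whose binary representation is $a_{i1}a_{i2}\cdots a_{im}$ (so $a_{i1}$ is the most significant bit), and let $c(A)=\langle y_1,\dots,y_m\rangle$ where $y_j$ is the natural number whose binary representation is $a_{1j}a_{2j}\cdots a_{nj}$ (so $a_{1j}$ is the most significant bit). The matrix $A$ is called semi-canonical if $x_1\le x_2\le\dots\le x_n$ and $y_1\le y_2\le\dots\le y_m$. -}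

module Defs where

open import Data.Nat using (ℕ; zero; suc; _+_; _*_; _≤_)
open import Data.Bool using (Bool; true; false)
open import Data.Fin using (Fin; toℕ)
open import Data.Product using (_×_)
open import Relation.Binary.PropositionalEquality using (_≡_)
open import Data.List using (List; []; _∷_; foldl)
open import Data.Vec.Functional using (toList)

BinMatrix : ℕ → ℕ → Set
BinMatrix n m = Fin n → Fin m → Bool

bit : Bool → ℕ
bit true  = 1
bit false = 0

-- Natural number whose binary representation is b₁ b₂ ⋯ bₖ (b₁ most significant).
fromBits : List Bool → ℕ
fromBits = foldl (λ acc b → 2 * acc + bit b) 0

rowVal : ∀ {n m} → BinMatrix n m → Fin n → ℕ
rowVal A i = fromBits (toList (λ j → A i j))

colVal : ∀ {n m} → BinMatrix n m → Fin m → ℕ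
colVal A j = fromBits (toList (λ i → A i j))

-- Semi-canonical: x₁ ≤ x₂ ≤ ⋯ ≤ xₙ and y₁ ≤ y₂ ≤ ⋯ ≤ yₘ, stated literally as
-- "each entry ≤ the next one" (consecutive indices).
NonDecreasing : ∀ {k} → (Fin k → ℕ) → Set
NonDecreasing {k} f = ∀ (i j : Fin k) → toℕ j ≡ suc (toℕ i) → f i ≤ f j

SemiCanonical : ∀ {n m} → BinMatrix n m → Set
SemiCanonical A = NonDecreasing (rowVal A) × NonDecreasing (colVal A)

-- A row or column whose bits read 0⋯01⋯1 has value 2ˢ − 1, and the first row of a matrix
-- with nondecreasing columns has this shape: a 1 followed by a 0 in row 1 would make one
-- column's value at least 2ⁿ⁻¹ while the next column's value is below 2ⁿ⁻¹. Transposing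
-- gives the same for the first column.
module Submission where

open import Defs
open import Data.Bool using (Bool; true; false)
open import Data.Empty using (⊥-elim)
open import Data.Fin using (Fin; zero; suc; toℕ)
open import Data.List using ([]; _∷_; foldl; length)
open import Data.List.Properties using (length-tabulate)
open import Data.Nat using (ℕ; zero; suc; _+_; _*_; _∸_; _^_; _≤_; _<_; s≤s; z≤n)
open import Data.Nat.Properties
open import Data.Nat.Tactic.RingSolver using (solve-∀)
open import Data.Product using (Σ; _×_; _,_)
open import Data.Vec.Functional using (toList; head; tail)
open import Function using (_∘_; flip)
open import Relation.Binary.PropositionalEquality

pushBit : ℕ → Bool → ℕ
pushBit acc b = 2 * acc + bit b

foldl-pushBit : ∀ acc bs → foldl pushBit acc bs ≡ acc * 2 ^ length bs + fromBits bs
foldl-pushBit acc [] = sym (trans (+-identityʳ (acc * 1)) (*-identityʳ acc))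
foldl-pushBit acc (b ∷ bs) = begin
  foldl pushBit (2 * acc + bit b) bs              ≡⟨ foldl-pushBit (2 * acc + bit b) bs ⟩
  (2 * acc + bit b) * 2 ^ L + fromBits bs         ≡⟨ regroup acc (bit b) (2 ^ L) (fromBits bs) ⟩
  acc * 2 ^ suc L + (bit b * 2 ^ L + fromBits bs) ≡⟨ cong (acc * 2 ^ suc L +_) (foldl-pushBit (bit b) bs) ⟨
  acc * 2 ^ suc L + fromBits (b ∷ bs)             ∎
  where
  open ≡-Reasoning
  L = length bs
  regroup : ∀ a c p f → (2 * a + c) * p + f ≡ a * (2 * p) + (c * p + f)
  regroup = solve-∀

value : ∀ {k} → (Fin k → Bool) → ℕ
value g = fromBits (toList g)

value-head : ∀ {k} (g : Fin (suc k) → Bool) → value g ≡ bit (head g) * 2 ^ k + value (tail g)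
value-head {k} g = trans (foldl-pushBit (bit (head g)) (toList (tail g)))
  (cong (λ L → bit (head g) * 2 ^ L + value (tail g)) (length-tabulate (tail g)))

bit*-≤ : ∀ b p → bit b * p ≤ p
bit*-≤ true  p = ≤-reflexive (*-identityˡ p)
bit*-≤ false p = z≤n

value<2^ : ∀ {k} (g : Fin k → Bool) → value g < 2 ^ k
value<2^ {zero}  g = s≤s z≤n
value<2^ {suc k} g = begin-strict
  value g                         ≡⟨ value-head g ⟩
  bit (head g) * p + value (tail g) <⟨ +-monoʳ-< (bit (head g) * p) (value<2^ (tail g)) ⟩
  bit (head g) * p + p            ≤⟨ +-monoˡ-≤ p (bit*-≤ (head g) p) ⟩
  p + p                           ≡⟨ cong (p +_) (+-identityʳ p) ⟨
  2 ^ suc k                       ∎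
  where
  open ≤-Reasoning
  p = 2 ^ k

head-true⇒2^≤value : ∀ {k} (g : Fin (suc k) → Bool) → head g ≡ true → 2 ^ k ≤ value g
head-true⇒2^≤value {k} g h rewrite value-head g | h =
  ≤-trans (m≤m+n (2 ^ k) 0) (m≤m+n (2 ^ k + 0) (value (tail g)))

head-false⇒value≡value-tail : ∀ {k} (g : Fin (suc k) → Bool) → head g ≡ false →
  value g ≡ value (tail g)
head-false⇒value≡value-tail g h rewrite value-head g | h = refl

value-allTrue : ∀ {k} (g : Fin k → Bool) → (∀ i → g i ≡ true) → value g + 1 ≡ 2 ^ k
value-allTrue {zero}  g all = refl
value-allTrue {suc k} g all = begin
  value g + 1                         ≡⟨ cong (_+ 1) (value-head g) ⟩
  bit (head g) * p + value (tail g) + 1 ≡⟨ cong (λ b → bit b * p + value (tail g) + 1) (all zero) ⟩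
  1 * p + value (tail g) + 1          ≡⟨ +-assoc (1 * p) (value (tail g)) 1 ⟩
  1 * p + (value (tail g) + 1)        ≡⟨ cong₂ _+_ (*-identityˡ p) (value-allTrue (tail g) (all ∘ suc)) ⟩
  p + p                               ≡⟨ cong (p +_) (+-identityʳ p) ⟨
  2 ^ suc k                           ∎
  where
  open ≡-Reasoning
  p = 2 ^ k

Ascending : ∀ {k} → (Fin k → Bool) → Set
Ascending {k} g = ∀ (i j : Fin k) → toℕ j ≡ suc (toℕ i) → g i ≡ true → g j ≡ true

ascending-tail : ∀ {k} {g : Fin (suc k) → Bool} → Ascending g → Ascending (tail g)
ascending-tail asc i j j≡1+i = asc (suc i) (suc j) (cong suc j≡1+i)

ascending-allTrue : ∀ {k} (g : Fin (suc k) → Bool) → Ascending g → head g ≡ true →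
  ∀ i → g i ≡ true
ascending-allTrue g asc h zero = h
ascending-allTrue {suc k} g asc h (suc i) =
  ascending-allTrue (tail g) (ascending-tail asc) (asc zero (suc zero) refl h) i

ascending⇒value≡2^-1 : ∀ {k} (g : Fin k → Bool) → Ascending g →
  Σ ℕ λ s → s ≤ k × value g + 1 ≡ 2 ^ s
ascending⇒value≡2^-1 {zero}  g asc = 0 , z≤n , refl
ascending⇒value≡2^-1 {suc k} g asc = byHead (head g) refl
  where
  byHead : ∀ b → head g ≡ b → Σ ℕ λ s → s ≤ suc k × value g + 1 ≡ 2 ^ s
  byHead true  h = suc k , ≤-refl , value-allTrue g (ascending-allTrue g asc h)
  byHead false h with s , s≤ , value-tail ← ascending⇒value≡2^-1 (tail g) (ascending-tail asc) =
    s , m≤n⇒m≤1+n s≤ , trans (cong (_+ 1) (head-false⇒value≡value-tail g h)) value-tail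

firstRow-ascending : ∀ {k l} (B : BinMatrix (suc k) l) → NonDecreasing (colVal B) →
  Ascending (B zero)
firstRow-ascending {k} B cols i j j≡1+i one with B zero j in zero-at-j
... | true  = refl
... | false = ⊥-elim (<⇒≱ j<i (cols i j j≡1+i))
  where
  j<i : colVal B j < colVal B i
  j<i = begin-strict
    colVal B j                   ≡⟨ head-false⇒value≡value-tail (λ r → B r j) zero-at-j ⟩
    value (λ r → B (suc r) j)    <⟨ value<2^ (λ r → B (suc r) j) ⟩
    2 ^ k                        ≤⟨ head-true⇒2^≤value (λ r → B r i) one ⟩
    colVal B i                   ∎
    where open ≤-Reasoning

firstRow≡2^-1 : ∀ {k l} (B : BinMatrix (suc k) l) → NonDecreasing (colVal B) →
  Σ ℕ λ s → s ≤ l × rowVal B zero ≡ 2 ^ s ∸ 1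
firstRow≡2^-1 B cols
  with s , s≤ , eq ← ascending⇒value≡2^-1 (B zero) (firstRow-ascending B cols) =
  s , s≤ , trans (sym (m+n∸n≡m (rowVal B zero) 1)) (cong (_∸ 1) eq)

corollary1 : (n m : ℕ) → (A : BinMatrix (suc n) (suc m)) → SemiCanonical A →
    Σ ℕ (λ s → Σ ℕ (λ t →
      (s ≤ suc m) × (t ≤ suc n) ×
      (rowVal A zero ≡ 2 ^ s ∸ 1) × (colVal A zero ≡ 2 ^ t ∸ 1)))
corollary1 n m A (rows , cols)
  with s , s≤ , row ← firstRow≡2^-1 A cols
     | t , t≤ , col ← firstRow≡2^-1 (flip A) rows =
  s , t , s≤ , t≤ , row , col
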